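{- Let $\Phi(x_1,x_2) = u_1x_1+u_2x_2$ be a binary linear form with relatively prime positive integer coefficients $u_1 < u_2$. Let $A$ be a finite set of integers and let $b$ be an integer. Then there exists a set $C$ of integers with $A \subseteq C$ and $|C\setminus A| = 2$ such that \[ R_{C,\Phi}(n) = \begin{cases} R_{A,\Phi}(b)+1 & \text{if } n=b,\\ R_{A,\Phi}(n) & \text{if } n \in \Phi(A)\setminus\{b\},\\ 1 & \text{if } n \in \Phi(C)\setminus\left(\Phi(A)\cup\{b\}\right),\\ 0 & \text{if } n \notin \Phi(C). \end{cases} \]
   Context: For a set $X$ of integers, $\Phi(X) = \{\Phi(a_1,a_2) : a_1,a_2 \in X\}$, and for each integer $n$, $R_{X,\Phi}(n) = \operatorname{card}\{(a_1,a_2) \in X\times X : \Phi(a_1,a_2) = n\}$ (ordered pairs). -}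

module Defs where

open import Data.Nat using (ℕ)
open import Data.Integer using (ℤ; +_; _+_; _*_; _≟_)
open import Data.List using (List; _∷_; length; filter; cartesianProduct)
open import Data.List.Membership.Propositional using (_∈_)
open import Data.Product using (_×_; _,_; ∃₂)
open import Relation.Binary.PropositionalEquality using (_≡_)

Φ : ℕ → ℕ → ℤ → ℤ → ℤ
Φ u₁ u₂ x₁ x₂ = (+ u₁) * x₁ + (+ u₂) * x₂

-- A finite set of integers is represented by a duplicate-free list.
-- R_{X,Φ}(n): number of ordered pairs (a₁,a₂) ∈ X × X with Φ(a₁,a₂) = n.
R : ℕ → ℕ → List ℤ → ℤ → ℕ
R u₁ u₂ X n = length (filter (λ p → Φ u₁ u₂ (Data.Product.proj₁ p) (Data.Product.proj₂ p) ≟ n)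
                             (cartesianProduct X X))

InΦ : ℕ → ℕ → List ℤ → ℤ → Set
InΦ u₁ u₂ X n = ∃₂ λ a₁ a₂ → a₁ ∈ X × a₂ ∈ X × Φ u₁ u₂ a₁ a₂ ≡ n

module Submission where

-- Pick x₀, y₀ with Φ(x₀,y₀) = b
-- (Bézout), a bound M for |x₀|, |y₀| and all |a|, a ∈ A, and a spacing S larger
-- than twice every |Φ(r,r')| with |r|,|r'| ≤ M.  Put
--     c₁ = u₂·S + x₀,   c₂ = -u₁·S + y₀,   so that Φ(c₁,c₂) = Φ(x₀,y₀) = b.
-- Say v is "at level k" when v = k·S + r with r small.  The elements of A have
-- level 0, c₁ and c₂ levels κ₁ = u₂ and κ₂ = -u₁, and Φ(x,y) has level
-- Φ(level x, level y).  Apart from (c₁,c₂) and the pairs of A × A, every pair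
-- of C = c₁ ∷ c₂ ∷ A lies in one of seven families with pairwise different
-- nonzero levels (Φ(u₂,0) ≠ Φ(-u₁,u₂) is where coprimality is used), and Φ is
-- injective on each family.  Hence these new values are pairwise distinct and
-- differ from b and from every value in Φ(A), which gives the four counts.

open import Defs
open import Data.Nat using (ℕ; _<_; suc)
open import Data.Nat.Coprimality using (Coprime)
open import Data.Integer using (ℤ)
open import Data.List using (List; _∷_)
open import Data.List.Membership.Propositional using (_∈_; _∉_)
open import Data.List.Relation.Unary.Unique.Propositional using (Unique)
open import Data.Product using (_×_; ∃₂)
open import Data.Sum using (_⊎_)
open import Relation.Binary.PropositionalEquality using (_≡_; _≢_)
open import Relation.Nullary using (¬_)

open import Data.Nat using (zero)
import Data.Nat as ℕ
import Data.Nat.Properties as ℕ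
open import Data.Nat.Divisibility using (_∣_; ∣⇒≤; ∣m+n∣m⇒∣n; n∣m*n; m∣m*n)
open import Data.Nat.Coprimality using (coprime-divisor; coprime-Bézout)
import Data.Nat.Coprimality as Coprimality
import Data.Nat.GCD as GCD
open import Data.Nat.ListAction using (sum)
open import Data.Integer
  using (+_; -_; _+_; _*_; _-_; 0ℤ; 1ℤ; ∣_∣; +<+; positive)
  renaming (_<_ to _<ℤ_)
import Data.Integer.Properties as ℤ
open import Data.Integer.Tactic.RingSolver using (solve-∀)
open import Data.List using ([]; _++_; map; filter; length; cartesianProduct)
open import Data.List.Properties using (filter-++; length-++; map-++; map-∘; ++-assoc)
open import Data.List.Membership.Propositional.Properties
  using (∈-map⁺; ∈-map⁻; ∈-++⁻; ∈-cartesianProduct⁺; ∈-cartesianProduct⁻)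
open import Data.List.Relation.Unary.Any using (here; there)
open import Data.List.Relation.Unary.All as All using (All; []; _∷_)
import Data.List.Relation.Unary.All.Properties as All
open import Data.List.Relation.Unary.AllPairs using ([]; _∷_)
import Data.List.Relation.Unary.Unique.Propositional.Properties as Unique
open import Data.List.Relation.Binary.Permutation.Propositional
  using (_↭_; prep; swap; ↭-refl; module PermutationReasoning)
open import Data.List.Relation.Binary.Permutation.Propositional.Properties
  using (↭-length; filter-↭; ++⁺ˡ; shifts; ∈-resp-↭)
open import Data.Product using (_,_; proj₁; proj₂; ∃)
open import Data.Sum using (inj₁; inj₂; [_,_])
open import Data.Empty using (⊥; ⊥-elim)
open import Function using (_∘_)
open import Relation.Binary.PropositionalEquality
  using (refl; sym; trans; cong; cong₂; subst; module ≡-Reasoning)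
open import Relation.Nullary using (Dec; yes; no)
open import Relation.Binary.Definitions using (tri<; tri≈; tri>)

×-cons-right : ∀ {A B : Set} (xs : List A) (y : B) ys →
  cartesianProduct xs (y ∷ ys) ↭ map (_, y) xs ++ cartesianProduct xs ys
×-cons-right [] y ys = ↭-refl
×-cons-right (x ∷ xs) y ys = prep (x , y) (begin
  map (x ,_) ys ++ cartesianProduct xs (y ∷ ys)
    ↭⟨ ++⁺ˡ (map (x ,_) ys) (×-cons-right xs y ys) ⟩
  map (x ,_) ys ++ map (_, y) xs ++ cartesianProduct xs ys
    ↭⟨ shifts (map (x ,_) ys) (map (_, y) xs) ⟩
  map (_, y) xs ++ map (x ,_) ys ++ cartesianProduct xs ys ∎)
  where open PermutationReasoning

square-cons : ∀ {A : Set} (x : A) X →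
  cartesianProduct (x ∷ X) (x ∷ X) ↭
  (x , x) ∷ map (x ,_) X ++ map (_, x) X ++ cartesianProduct X X
square-cons x X = prep (x , x) (++⁺ˡ (map (x ,_) X) (×-cons-right X x X))

module Counting (u₁ u₂ : ℕ) where

  φ : ℤ → ℤ → ℤ
  φ = Φ u₁ u₂

  φ² : ℤ × ℤ → ℤ
  φ² p = φ (proj₁ p) (proj₂ p)

  hits? : ∀ n p → Dec (φ² p ≡ n)
  hits? n p = φ² p ℤ.≟ n

  hits : ℤ → List (ℤ × ℤ) → ℕ
  hits n L = length (filter (hits? n) L)

  hits-↭ : ∀ n {L L'} → L ↭ L' → hits n L ≡ hits n L'
  hits-↭ n L↭L' = ↭-length (filter-↭ (hits? n) L↭L')

  hits-++ : ∀ n L L' → hits n (L ++ L') ≡ hits n L ℕ.+ hits n L'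
  hits-++ n L L' = trans (cong length (filter-++ (hits? n) L L')) (length-++ (filter (hits? n) L))

  hits-absent : ∀ n L → n ∉ map φ² L → hits n L ≡ 0
  hits-absent n [] _ = refl
  hits-absent n (p ∷ L) n∉ with hits? n p
  ... | yes φp≡n = ⊥-elim (n∉ (here (sym φp≡n)))
  ... | no _ = hits-absent n L (n∉ ∘ there)

  hits-once : ∀ n L → Unique (map φ² L) → n ∈ map φ² L → hits n L ≡ 1
  hits-once n (p ∷ L) (φp∉ ∷ unique) n∈ with hits? n p | n∈
  ... | yes refl | _ = cong suc (hits-absent n L λ n∈L → All.lookup φp∉ n∈L refl)
  ... | no φp≢n | here n≡φp = ⊥-elim (φp≢n (sym n≡φp))
  ... | no _ | there n∈L = hits-once n L unique n∈L

  R-absent : ∀ X n → ¬ InΦ u₁ u₂ X n → R u₁ u₂ X n ≡ 0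
  R-absent X n n∉ΦX = hits-absent n (cartesianProduct X X) λ n∈ →
    let (x , y) , xy∈ , n≡φxy = ∈-map⁻ φ² n∈
        x∈ , y∈ = ∈-cartesianProduct⁻ X X xy∈
    in n∉ΦX (x , y , x∈ , y∈ , sym n≡φxy)

  -- The pairs of (c₁ ∷ c₂ ∷ A)² other than (c₁, c₂) and those of A × A; the
  -- first group has positive levels, the second negative ones.
  positivePairs negativePairs newPairs : ℤ → ℤ → List ℤ → List (ℤ × ℤ)
  positivePairs c₁ c₂ A = (c₁ , c₁) ∷ map (c₁ ,_) A ++ (c₂ , c₁) ∷ map (_, c₁) A
  negativePairs c₁ c₂ A = (c₂ , c₂) ∷ map (c₂ ,_) A ++ map (_, c₂) A
  newPairs c₁ c₂ A = positivePairs c₁ c₂ A ++ negativePairs c₁ c₂ A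

  square-split : ∀ c₁ c₂ A →
    cartesianProduct (c₁ ∷ c₂ ∷ A) (c₁ ∷ c₂ ∷ A) ↭
    (c₁ , c₂) ∷ newPairs c₁ c₂ A ++ cartesianProduct A A
  square-split c₁ c₂ A = begin
    cartesianProduct C C
      ↭⟨ square-cons c₁ (c₂ ∷ A) ⟩
    (c₁ , c₁) ∷ (c₁ , c₂) ∷ m₁ ++ (c₂ , c₁) ∷ n₁ ++ cartesianProduct (c₂ ∷ A) (c₂ ∷ A)
      ↭⟨ swap (c₁ , c₁) (c₁ , c₂) (++⁺ˡ m₁ (prep (c₂ , c₁) (++⁺ˡ n₁ (square-cons c₂ A)))) ⟩
    (c₁ , c₂) ∷ (c₁ , c₁) ∷ m₁ ++ (c₂ , c₁) ∷ n₁ ++ (c₂ , c₂) ∷ m₂ ++ n₂ ++ A²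
      ≡⟨ cong ((c₁ , c₂) ∷_) regroup ⟨
    (c₁ , c₂) ∷ newPairs c₁ c₂ A ++ A² ∎
    where
    open PermutationReasoning
    C = c₁ ∷ c₂ ∷ A
    A² = cartesianProduct A A
    m₁ = map (c₁ ,_) A
    n₁ = map (_, c₁) A
    m₂ = map (c₂ ,_) A
    n₂ = map (_, c₂) A
    regroup : newPairs c₁ c₂ A ++ A² ≡
              (c₁ , c₁) ∷ m₁ ++ (c₂ , c₁) ∷ n₁ ++ (c₂ , c₂) ∷ m₂ ++ n₂ ++ A²
    regroup = trans (++-assoc (positivePairs c₁ c₂ A) (negativePairs c₁ c₂ A) A²)
      (trans (cong ((c₁ , c₁) ∷_) (++-assoc m₁ ((c₂ , c₁) ∷ n₁) _))
             (cong (λ t → (c₁ , c₁) ∷ m₁ ++ (c₂ , c₁) ∷ n₁ ++ (c₂ , c₂) ∷ t) (++-assoc m₂ n₂ A²)))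

  R-split : ∀ c₁ c₂ A n → R u₁ u₂ (c₁ ∷ c₂ ∷ A) n ≡
    hits n ((c₁ , c₂) ∷ []) ℕ.+ hits n (newPairs c₁ c₂ A) ℕ.+ R u₁ u₂ A n
  R-split c₁ c₂ A n = begin
    R u₁ u₂ (c₁ ∷ c₂ ∷ A) n
      ≡⟨ hits-↭ n (square-split c₁ c₂ A) ⟩
    hits n ((c₁ , c₂) ∷ new ++ cartesianProduct A A)
      ≡⟨ hits-++ n ((c₁ , c₂) ∷ new) (cartesianProduct A A) ⟩
    hits n ((c₁ , c₂) ∷ new) ℕ.+ R u₁ u₂ A n
      ≡⟨ cong (ℕ._+ R u₁ u₂ A n) (hits-++ n ((c₁ , c₂) ∷ []) new) ⟩
    hits n ((c₁ , c₂) ∷ []) ℕ.+ hits n new ℕ.+ R u₁ u₂ A n ∎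
    where
    open ≡-Reasoning
    new = newPairs c₁ c₂ A

  InΦ-split : ∀ c₁ c₂ A n → InΦ u₁ u₂ (c₁ ∷ c₂ ∷ A) n →
    n ≡ φ c₁ c₂ ⊎ n ∈ map φ² (newPairs c₁ c₂ A) ⊎ InΦ u₁ u₂ A n
  InΦ-split c₁ c₂ A n (x , y , x∈C , y∈C , refl)
    with ∈-resp-↭ (square-split c₁ c₂ A) (∈-cartesianProduct⁺ x∈C y∈C)
  ... | here refl = inj₁ refl
  ... | there xy∈ with ∈-++⁻ (newPairs c₁ c₂ A) xy∈
  ...   | inj₁ xy∈new = inj₂ (inj₁ (∈-map⁺ φ² xy∈new))
  ...   | inj₂ xy∈A² = let x∈A , y∈A = ∈-cartesianProduct⁻ A A xy∈A²
                       in inj₂ (inj₂ (x , y , x∈A , y∈A , refl))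

  RequiredCounts : List ℤ → ℤ → ℤ → ℤ → Set
  RequiredCounts A b c₁ c₂ =
    let C = c₁ ∷ c₂ ∷ A in
      (R u₁ u₂ C b ≡ suc (R u₁ u₂ A b))
      × (∀ n → InΦ u₁ u₂ A n → n ≢ b → R u₁ u₂ C n ≡ R u₁ u₂ A n)
      × (∀ n → InΦ u₁ u₂ C n → ¬ (InΦ u₁ u₂ A n ⊎ n ≡ b) → R u₁ u₂ C n ≡ 1)
      × (∀ n → ¬ InΦ u₁ u₂ C n → R u₁ u₂ C n ≡ 0)

  required-counts : ∀ A b c₁ c₂ → φ c₁ c₂ ≡ b →
    Unique (map φ² (newPairs c₁ c₂ A)) →
    (∀ n → n ≡ b ⊎ InΦ u₁ u₂ A n → n ∉ map φ² (newPairs c₁ c₂ A)) →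
    RequiredCounts A b c₁ c₂
  required-counts A b c₁ c₂ refl unique fresh =
    count-b , count-old , count-new , R-absent (c₁ ∷ c₂ ∷ A)
    where
    new = newPairs c₁ c₂ A
    hit-b : ∀ {n} → b ≡ n → hits n ((c₁ , c₂) ∷ []) ≡ 1
    hit-b b≡n = hits-once _ ((c₁ , c₂) ∷ []) ([] ∷ []) (here (sym b≡n))
    miss-b : ∀ {n} → b ≢ n → hits n ((c₁ , c₂) ∷ []) ≡ 0
    miss-b b≢n = hits-absent _ ((c₁ , c₂) ∷ []) λ { (here n≡b) → b≢n (sym n≡b) }
    count-b : R u₁ u₂ (c₁ ∷ c₂ ∷ A) b ≡ suc (R u₁ u₂ A b)
    count-b = trans (R-split c₁ c₂ A b)
      (cong₂ (λ i j → i ℕ.+ j ℕ.+ R u₁ u₂ A b)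
             (hit-b refl) (hits-absent b new (fresh b (inj₁ refl))))
    count-old : ∀ n → InΦ u₁ u₂ A n → n ≢ b → R u₁ u₂ (c₁ ∷ c₂ ∷ A) n ≡ R u₁ u₂ A n
    count-old n n∈ΦA n≢b = trans (R-split c₁ c₂ A n)
      (cong₂ (λ i j → i ℕ.+ j ℕ.+ R u₁ u₂ A n)
             (miss-b (n≢b ∘ sym)) (hits-absent n new (fresh n (inj₂ n∈ΦA))))
    count-new : ∀ n → InΦ u₁ u₂ (c₁ ∷ c₂ ∷ A) n → ¬ (InΦ u₁ u₂ A n ⊎ n ≡ b) →
      R u₁ u₂ (c₁ ∷ c₂ ∷ A) n ≡ 1
    count-new n n∈ΦC n-new with InΦ-split c₁ c₂ A n n∈ΦC
    ... | inj₁ n≡b = ⊥-elim (n-new (inj₂ n≡b))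
    ... | inj₂ (inj₂ n∈ΦA) = ⊥-elim (n-new (inj₁ n∈ΦA))
    ... | inj₂ (inj₁ n∈new) = trans (R-split c₁ c₂ A n)
      (cong₂ ℕ._+_ (cong₂ ℕ._+_ (miss-b λ b≡n → n-new (inj₂ (sym b≡n)))
                                (hits-once n new unique n∈new))
                   (R-absent A n (n-new ∘ inj₁)))

swap-< : ∀ {p q x y} → p <ℤ q → x <ℤ y → p * y + q * x <ℤ p * x + q * y
swap-< {p} {q} {x} {y} p<q x<y = begin-strict
  p * y + q * x                 ≡⟨ split-x p q x y ⟨
  (q - p) * x + (p * x + p * y) <⟨ ℤ.+-monoˡ-< (p * x + p * y) (scaled x<y) ⟩
  (q - p) * y + (p * x + p * y) ≡⟨ split-y p q x y ⟩
  p * x + q * y                 ∎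
  where
  open ℤ.≤-Reasoning
  0<q-p : 0ℤ <ℤ q - p
  0<q-p = subst (_<ℤ q - p) (ℤ.+-inverseʳ p) (ℤ.+-monoˡ-< (- p) p<q)
  scaled : x <ℤ y → (q - p) * x <ℤ (q - p) * y
  scaled = ℤ.*-monoˡ-<-pos (q - p) {{positive 0<q-p}}
  split-x : ∀ p q x y → (q - p) * x + (p * x + p * y) ≡ p * y + q * x
  split-x = solve-∀
  split-y : ∀ p q x y → (q - p) * y + (p * x + p * y) ≡ p * x + q * y
  split-y = solve-∀

increasing⇒injective : (f : ℤ → ℤ) → (∀ {x x'} → x <ℤ x' → f x <ℤ f x') →
  ∀ {x x'} → f x ≡ f x' → x ≡ x'
increasing⇒injective f increasing {x} {x'} fx≡fx' with ℤ.<-cmp x x'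
... | tri< x<x' _ _ = ⊥-elim (ℤ.<⇒≢ (increasing x<x') fx≡fx')
... | tri≈ _ x≡x' _ = x≡x'
... | tri> _ _ x'<x = ⊥-elim (ℤ.<⇒≢ (increasing x'<x) (sym fx≡fx'))

-- u₂² = u₁u₂ + u₁² has no solution with 0 < u₁ < u₂ coprime: u₂ would divide
-- u₁², hence u₁.
no-golden-pair : ∀ {u₁ u₂} → 0 < u₁ → u₁ < u₂ → Coprime u₁ u₂ →
  u₁ ℕ.* u₂ ℕ.+ u₁ ℕ.* u₁ ≢ u₂ ℕ.* u₂
no-golden-pair {u₁} {u₂} 0<u₁ u₁<u₂ coprime e = ℕ.<⇒≱ u₁<u₂ (∣⇒≤ {{ℕ.>-nonZero 0<u₁}} u₂∣u₁)
  where
  u₂∣u₁u₁ : u₂ ∣ u₁ ℕ.* u₁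
  u₂∣u₁u₁ = ∣m+n∣m⇒∣n (subst (u₂ ∣_) (sym e) (m∣m*n u₂)) (n∣m*n u₁)
  u₂∣u₁ : u₂ ∣ u₁
  u₂∣u₁ = coprime-divisor (Coprimality.sym coprime) u₂∣u₁u₁

-- c₁ and c₂ will sit at the levels κ₁ = u₂ and κ₂ = -u₁, chosen so that
-- Φ(κ₁,κ₂) = 0; elements of A sit at level 0.  A new pair (x, y) has level
-- Φ(level x, level y), and these seven levels are nonzero and distinct:
--   Φ(κ₂,κ₂) < Φ(0,κ₂) < Φ(κ₂,0) < 0 < Φ(κ₁,0), Φ(κ₂,κ₁) < Φ(0,κ₁) < Φ(κ₁,κ₁),
--   Φ(κ₁,0) ≠ Φ(κ₂,κ₁).
module Levels (u₁ u₂ : ℕ) (0<u₁ : 0 < u₁) (u₁<u₂ : u₁ < u₂) (coprime : Coprime u₁ u₂) where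
  open Counting u₁ u₂ using (φ)

  κ₁ κ₂ : ℤ
  κ₁ = + u₂
  κ₂ = - (+ u₁)

  φ-mono₁ : ∀ {x x' y} → x <ℤ x' → φ x y <ℤ φ x' y
  φ-mono₁ {y = y} x<x' =
    ℤ.+-monoˡ-< (+ u₂ * y) (ℤ.*-monoˡ-<-pos (+ u₁) {{positive (+<+ 0<u₁)}} x<x')

  φ-mono₂ : ∀ {x y y'} → y <ℤ y' → φ x y <ℤ φ x y'
  φ-mono₂ {x} y<y' =
    ℤ.+-monoʳ-< (+ u₁ * x) (ℤ.*-monoˡ-<-pos (+ u₂) {{positive (+<+ (ℕ.<-trans 0<u₁ u₁<u₂))}} y<y')

  φ-cancel₁ : ∀ {x x' y} → φ x y ≡ φ x' y → x ≡ x'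
  φ-cancel₁ {y = y} = increasing⇒injective (λ x → φ x y) φ-mono₁

  φ-cancel₂ : ∀ {x y y'} → φ x y ≡ φ x y' → y ≡ y'
  φ-cancel₂ {x} = increasing⇒injective (φ x) φ-mono₂

  φ-swap : ∀ {x y} → x <ℤ y → φ y x <ℤ φ x y
  φ-swap = swap-< (+<+ u₁<u₂)

  -- The pairs of level 0: those of A × A and (c₁, c₂).
  φ-origin : φ 0ℤ 0ℤ ≡ 0ℤ
  φ-origin = vanish (+ u₁) (+ u₂)
    where
    vanish : ∀ a b → a * 0ℤ + b * 0ℤ ≡ 0ℤ
    vanish = solve-∀

  φ-κ₁κ₂ : φ κ₁ κ₂ ≡ 0ℤ
  φ-κ₁κ₂ = cancel (+ u₁) (+ u₂)
    where
    cancel : ∀ a b → a * b + b * (- a) ≡ 0ℤ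
    cancel = solve-∀

  κ₂<0 : κ₂ <ℤ 0ℤ
  κ₂<0 = ℤ.neg-mono-< (+<+ 0<u₁)

  0<κ₁ : 0ℤ <ℤ κ₁
  0<κ₁ = +<+ (ℕ.<-trans 0<u₁ u₁<u₂)

  -- The order of the levels ℓᵢⱼ = Φ(κᵢ,κⱼ), where κ₀ = 0.
  ℓ₂₂<ℓ₀₂ : φ κ₂ κ₂ <ℤ φ 0ℤ κ₂
  ℓ₂₂<ℓ₀₂ = φ-mono₁ κ₂<0

  ℓ₀₂<ℓ₂₀ : φ 0ℤ κ₂ <ℤ φ κ₂ 0ℤ
  ℓ₀₂<ℓ₂₀ = φ-swap κ₂<0

  ℓ₂₀<0 : φ κ₂ 0ℤ <ℤ 0ℤ
  ℓ₂₀<0 = subst (φ κ₂ 0ℤ <ℤ_) φ-origin (φ-mono₁ κ₂<0)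

  0<ℓ₁₀ : 0ℤ <ℤ φ κ₁ 0ℤ
  0<ℓ₁₀ = subst (_<ℤ φ κ₁ 0ℤ) φ-origin (φ-mono₁ 0<κ₁)

  ℓ₁₀<ℓ₀₁ : φ κ₁ 0ℤ <ℤ φ 0ℤ κ₁
  ℓ₁₀<ℓ₀₁ = φ-swap 0<κ₁

  ℓ₀₁<ℓ₁₁ : φ 0ℤ κ₁ <ℤ φ κ₁ κ₁
  ℓ₀₁<ℓ₁₁ = φ-mono₁ 0<κ₁

  0<ℓ₂₁ : 0ℤ <ℤ φ κ₂ κ₁
  0<ℓ₂₁ = subst (_<ℤ φ κ₂ κ₁) φ-κ₁κ₂ (φ-swap (ℤ.<-trans κ₂<0 0<κ₁))

  ℓ₂₁<ℓ₀₁ : φ κ₂ κ₁ <ℤ φ 0ℤ κ₁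
  ℓ₂₁<ℓ₀₁ = φ-mono₁ κ₂<0

  -- The two positive levels not compared above differ by coprimality.
  ℓ₁₀≢ℓ₂₁ : φ κ₁ 0ℤ ≢ φ κ₂ κ₁
  ℓ₁₀≢ℓ₂₁ e = no-golden-pair 0<u₁ u₁<u₂ coprime (ℤ.+-injective (begin
    + (u₁ ℕ.* u₂ ℕ.+ u₁ ℕ.* u₁)    ≡⟨ ℤ.pos-+ (u₁ ℕ.* u₂) (u₁ ℕ.* u₁) ⟩
    + (u₁ ℕ.* u₂) + + (u₁ ℕ.* u₁)  ≡⟨ cong₂ _+_ (ℤ.pos-* u₁ u₂) (ℤ.pos-* u₁ u₁) ⟩
    + u₁ * + u₂ + + u₁ * + u₁      ≡⟨ add-square (+ u₁) (+ u₂) ⟩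
    φ κ₁ 0ℤ + + u₁ * + u₁         ≡⟨ cong (_+ + u₁ * + u₁) e ⟩
    φ κ₂ κ₁ + + u₁ * + u₁         ≡⟨ complete-square (+ u₁) (+ u₂) ⟩
    + u₂ * + u₂                    ≡⟨ ℤ.pos-* u₂ u₂ ⟨
    + (u₂ ℕ.* u₂)                  ∎))
    where
    open ≡-Reasoning
    add-square : ∀ a b → a * b + a * a ≡ (a * b + b * 0ℤ) + a * a
    add-square = solve-∀
    complete-square : ∀ a b → (a * (- a) + b * b) + a * a ≡ b * b
    complete-square = solve-∀

multiple-bound : ∀ m n → m ℕ.* suc n ℕ.≤ n → m ≡ 0
multiple-bound zero n _ = refl
multiple-bound (suc m) n le = ⊥-elim (ℕ.<-irrefl refl (ℕ.≤-trans (ℕ.m≤m+n (suc n) (m ℕ.* suc n)) le))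

module Separation (u₁ u₂ M : ℕ) where
  open Counting u₁ u₂ using (φ; φ²)

  K : ℕ
  K = (u₁ ℕ.+ u₂) ℕ.* M

  S : ℤ
  S = + suc (K ℕ.+ K)

  record Near (B : ℕ) (k v : ℤ) : Set where
    constructor near
    field
      offset : ℤ
      small : ∣ offset ∣ ℕ.≤ B
      at : v ≡ k * S + offset

  φ-bound : ∀ {r r'} → ∣ r ∣ ℕ.≤ M → ∣ r' ∣ ℕ.≤ M → ∣ φ r r' ∣ ℕ.≤ K
  φ-bound {r} {r'} r≤M r'≤M = begin
    ∣ + u₁ * r + + u₂ * r' ∣              ≤⟨ ℤ.∣i+j∣≤∣i∣+∣j∣ (+ u₁ * r) (+ u₂ * r') ⟩
    ∣ + u₁ * r ∣ ℕ.+ ∣ + u₂ * r' ∣        ≡⟨ cong₂ ℕ._+_ (ℤ.abs-* (+ u₁) r) (ℤ.abs-* (+ u₂) r') ⟩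
    u₁ ℕ.* ∣ r ∣ ℕ.+ u₂ ℕ.* ∣ r' ∣        ≤⟨ ℕ.+-mono-≤ (ℕ.*-monoʳ-≤ u₁ r≤M) (ℕ.*-monoʳ-≤ u₂ r'≤M) ⟩
    u₁ ℕ.* M ℕ.+ u₂ ℕ.* M                 ≡⟨ ℕ.*-distribʳ-+ M u₁ u₂ ⟨
    K                                     ∎
    where open ℕ.≤-Reasoning

  -- Φ is bilinear, so the level of Φ(x,y) is Φ(level x, level y).
  near-φ : ∀ {p q x y} → Near M p x → Near M q y → Near K (φ p q) (φ x y)
  near-φ {p} {q} (near r r≤M refl) (near r' r'≤M refl) =
    near (φ r r') (φ-bound r≤M r'≤M) (bilinear (+ u₁) (+ u₂) p q S r r')
    where
    bilinear : ∀ a b p q S r r' →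
      a * (p * S + r) + b * (q * S + r') ≡ (a * p + b * q) * S + (a * r + b * r')
    bilinear = solve-∀

  -- Offsets of size at most K cannot bridge the gap S between two levels:
  -- (k - k')·S = r' - r with |r' - r| ≤ 2K < S forces k = k'.
  near-unique : ∀ {B k k' v} → B ℕ.≤ K → Near B k v → Near B k' v → k ≡ k'
  near-unique {B} {k} {k'} B≤K (near r r≤B refl) (near r' r'≤B e) =
    ℤ.i-j≡0⇒i≡j k k' (ℤ.∣i∣≡0⇒i≡0 (multiple-bound ∣ k - k' ∣ (K ℕ.+ K) (begin
      ∣ k - k' ∣ ℕ.* suc (K ℕ.+ K) ≡⟨ ℤ.abs-* (k - k') S ⟨
      ∣ (k - k') * S ∣             ≡⟨ cong ∣_∣ gap ⟩
      ∣ r' - r ∣                   ≤⟨ ℤ.∣i-j∣≤∣i∣+∣j∣ r' r ⟩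
      ∣ r' ∣ ℕ.+ ∣ r ∣             ≤⟨ ℕ.+-mono-≤ (ℕ.≤-trans r'≤B B≤K) (ℕ.≤-trans r≤B B≤K) ⟩
      K ℕ.+ K                      ∎)))
    where
    open ℕ.≤-Reasoning
    difference : ∀ k k' S r → (k - k') * S ≡ (k * S + r) - (k' * S + r)
    difference = solve-∀
    cancel : ∀ k' S r r' → (k' * S + r') - (k' * S + r) ≡ r' - r
    cancel = solve-∀
    gap : (k - k') * S ≡ r' - r
    gap = trans (difference k k' S r) (trans (cong (_- (k' * S + r)) e) (cancel k' S r r'))

  LevelIn : (ℤ → Set) → ℤ × ℤ → Set
  LevelIn P p = ∃ λ k → P k × Near K k (φ² p)

  Spread : (ℤ → Set) → List (ℤ × ℤ) → Set
  Spread P L = Unique (map φ² L) × All (LevelIn P) L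

  level-of : ∀ {P L v} → All (LevelIn P) L → v ∈ map φ² L → ∃ λ k → P k × Near K k v
  level-of levels v∈ with ∈-map⁻ φ² v∈
  ... | p , p∈L , refl = All.lookup levels p∈L

  spread-excludes : ∀ {P L k v} → Spread P L → Near K k v → ¬ P k → v ∉ map φ² L
  spread-excludes {P} (_ , levels) v-near ¬Pk v∈ =
    let k' , Pk' , v-near' = level-of levels v∈
    in ¬Pk (subst P (near-unique ℕ.≤-refl v-near' v-near) Pk')

  spread-single : ∀ {k p} → Near K k (φ² p) → Spread (_≡ k) (p ∷ [])
  spread-single p-near = [] ∷ [] , (_ , refl , p-near) ∷ []

  spread-family : ∀ {k A} (f : ℤ → ℤ × ℤ) →
    (∀ {a a'} → φ² (f a) ≡ φ² (f a') → a ≡ a') → Unique A →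
    (∀ {a} → a ∈ A → Near K k (φ² (f a))) → Spread (_≡ k) (map f A)
  spread-family {A = A} f injective A-unique f-near =
    subst Unique (map-∘ A) (Unique.map⁺ injective A-unique) ,
    All.map⁺ (All.tabulate λ a∈ → _ , refl , f-near a∈)

  spread-join : ∀ {P Q L L'} → (∀ {k} → P k → Q k → ⊥) →
    Spread P L → Spread Q L' → Spread (λ k → P k ⊎ Q k) (L ++ L')
  spread-join {P} {Q} {L} {L'} disjoint (unique , levels) (unique' , levels') =
    subst Unique (sym (map-++ φ² L L')) (Unique.++⁺ unique unique' apart) ,
    All.++⁺ (All.map (λ (k , Pk , p-near) → k , inj₁ Pk , p-near) levels)
            (All.map (λ (k , Qk , p-near) → k , inj₂ Qk , p-near) levels')
    where
    apart : ∀ {v} → ¬ (v ∈ map φ² L × v ∈ map φ² L')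
    apart (v∈L , v∈L') =
      let k , Pk , v-near = level-of levels v∈L
          k' , Qk' , v-near' = level-of levels' v∈L'
      in disjoint Pk (subst Q (near-unique ℕ.≤-refl v-near' v-near) Qk')

  spread-weaken : ∀ {P Q L} → (∀ {k} → P k → Q k) → Spread P L → Spread Q L
  spread-weaken P⊆Q (unique , levels) =
    unique , All.map (λ (k , Pk , p-near) → k , P⊆Q Pk , p-near) levels

module Construction (u₁ u₂ : ℕ) (0<u₁ : 0 < u₁) (u₁<u₂ : u₁ < u₂) (coprime : Coprime u₁ u₂)
  (A : List ℤ) (A-unique : Unique A) (b x₀ y₀ : ℤ) (x₀y₀↦b : Φ u₁ u₂ x₀ y₀ ≡ b)
  (M : ℕ) (x₀-small : ∣ x₀ ∣ ℕ.≤ M) (y₀-small : ∣ y₀ ∣ ℕ.≤ M) (A-small : ∀ {a} → a ∈ A → ∣ a ∣ ℕ.≤ M)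
  where
  open Counting u₁ u₂
  open Levels u₁ u₂ 0<u₁ u₁<u₂ coprime
  open Separation u₁ u₂ M

  c₁ c₂ : ℤ
  c₁ = κ₁ * S + x₀
  c₂ = κ₂ * S + y₀

  c₁-near : Near M κ₁ c₁
  c₁-near = near x₀ x₀-small refl

  c₂-near : Near M κ₂ c₂
  c₂-near = near y₀ y₀-small refl

  level-zero : ∀ {r} → ∣ r ∣ ℕ.≤ M → Near M 0ℤ r
  level-zero {r} r≤M = near r r≤M (sym (ℤ.+-identityˡ r))

  A-near : ∀ {a} → a ∈ A → Near M 0ℤ a
  A-near = level-zero ∘ A-small

  -- Elements at different levels differ; so c₁, c₂ and A are distinct.
  M≤K : M ℕ.≤ K
  M≤K = ℕ.m≤n*m M (u₁ ℕ.+ u₂) {{ℕ.>-nonZero (ℕ.<-≤-trans 0<u₁ (ℕ.m≤m+n u₁ u₂))}}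

  c₁≢c₂ : c₁ ≢ c₂
  c₁≢c₂ c₁≡c₂ = ℤ.<⇒≢ (ℤ.<-trans κ₂<0 0<κ₁)
    (sym (near-unique M≤K c₁-near (subst (Near M κ₂) (sym c₁≡c₂) c₂-near)))

  c₁∉A : c₁ ∉ A
  c₁∉A c₁∈A = ℤ.<⇒≢ 0<κ₁ (sym (near-unique M≤K c₁-near (A-near c₁∈A)))

  c₂∉A : c₂ ∉ A
  c₂∉A c₂∈A = ℤ.<⇒≢ κ₂<0 (near-unique M≤K c₂-near (A-near c₂∈A))

  -- The level of (c₁, c₂) is Φ(κ₁,κ₂) = 0, so Φ(c₁,c₂) = Φ(x₀,y₀) = b.
  c₁c₂↦b : φ c₁ c₂ ≡ b
  c₁c₂↦b = begin
    φ c₁ c₂               ≡⟨ Near.at (near-φ c₁-near c₂-near) ⟩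
    φ κ₁ κ₂ * S + φ x₀ y₀ ≡⟨ cong (λ k → k * S + φ x₀ y₀) φ-κ₁κ₂ ⟩
    0ℤ * S + φ x₀ y₀      ≡⟨ ℤ.+-identityˡ (φ x₀ y₀) ⟩
    φ x₀ y₀               ≡⟨ x₀y₀↦b ⟩
    b                     ∎
    where open ≡-Reasoning

  -- Pairs with positive levels Φ(κ₁,κ₁) | Φ(κ₁,0) | Φ(κ₂,κ₁) | Φ(0,κ₁).
  positive-spread : Spread (0ℤ <ℤ_) (positivePairs c₁ c₂ A)
  positive-spread = spread-weaken all-positive
    (spread-join top (spread-single (near-φ c₁-near c₁-near))
      (spread-join middle (spread-family (c₁ ,_) φ-cancel₂ A-unique (near-φ c₁-near ∘ A-near))
        (spread-join bottom (spread-single (near-φ c₂-near c₁-near))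
          (spread-family (_, c₁) φ-cancel₁ A-unique (λ a∈A → near-φ (A-near a∈A) c₁-near)))))
    where
    ℓ₂₁<ℓ₁₁ = ℤ.<-trans ℓ₂₁<ℓ₀₁ ℓ₀₁<ℓ₁₁
    ℓ₁₀<ℓ₁₁ = ℤ.<-trans ℓ₁₀<ℓ₀₁ ℓ₀₁<ℓ₁₁
    bottom : ∀ {k} → k ≡ φ κ₂ κ₁ → k ≡ φ 0ℤ κ₁ → ⊥
    bottom refl = ℤ.<⇒≢ ℓ₂₁<ℓ₀₁
    middle : ∀ {k} → k ≡ φ κ₁ 0ℤ → k ≡ φ κ₂ κ₁ ⊎ k ≡ φ 0ℤ κ₁ → ⊥
    middle refl (inj₁ e) = ℓ₁₀≢ℓ₂₁ e
    middle refl (inj₂ e) = ℤ.<⇒≢ ℓ₁₀<ℓ₀₁ e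
    top : ∀ {k} → k ≡ φ κ₁ κ₁ → k ≡ φ κ₁ 0ℤ ⊎ k ≡ φ κ₂ κ₁ ⊎ k ≡ φ 0ℤ κ₁ → ⊥
    top refl (inj₁ e) = ℤ.<⇒≢ ℓ₁₀<ℓ₁₁ (sym e)
    top refl (inj₂ (inj₁ e)) = ℤ.<⇒≢ ℓ₂₁<ℓ₁₁ (sym e)
    top refl (inj₂ (inj₂ e)) = ℤ.<⇒≢ ℓ₀₁<ℓ₁₁ (sym e)
    all-positive : ∀ {k} → k ≡ φ κ₁ κ₁ ⊎ k ≡ φ κ₁ 0ℤ ⊎ k ≡ φ κ₂ κ₁ ⊎ k ≡ φ 0ℤ κ₁ → 0ℤ <ℤ k
    all-positive (inj₁ refl) = ℤ.<-trans 0<ℓ₁₀ ℓ₁₀<ℓ₁₁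
    all-positive (inj₂ (inj₁ refl)) = 0<ℓ₁₀
    all-positive (inj₂ (inj₂ (inj₁ refl))) = 0<ℓ₂₁
    all-positive (inj₂ (inj₂ (inj₂ refl))) = ℤ.<-trans 0<ℓ₁₀ ℓ₁₀<ℓ₀₁

  -- Pairs with negative levels Φ(κ₂,κ₂) | Φ(κ₂,0) | Φ(0,κ₂).
  negative-spread : Spread (_<ℤ 0ℤ) (negativePairs c₁ c₂ A)
  negative-spread = spread-weaken all-negative
    (spread-join top (spread-single (near-φ c₂-near c₂-near))
      (spread-join bottom (spread-family (c₂ ,_) φ-cancel₂ A-unique (near-φ c₂-near ∘ A-near))
        (spread-family (_, c₂) φ-cancel₁ A-unique (λ a∈A → near-φ (A-near a∈A) c₂-near))))
    where
    bottom : ∀ {k} → k ≡ φ κ₂ 0ℤ → k ≡ φ 0ℤ κ₂ → ⊥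
    bottom refl e = ℤ.<⇒≢ ℓ₀₂<ℓ₂₀ (sym e)
    top : ∀ {k} → k ≡ φ κ₂ κ₂ → k ≡ φ κ₂ 0ℤ ⊎ k ≡ φ 0ℤ κ₂ → ⊥
    top refl (inj₁ e) = ℤ.<⇒≢ (ℤ.<-trans ℓ₂₂<ℓ₀₂ ℓ₀₂<ℓ₂₀) e
    top refl (inj₂ e) = ℤ.<⇒≢ ℓ₂₂<ℓ₀₂ e
    all-negative : ∀ {k} → k ≡ φ κ₂ κ₂ ⊎ k ≡ φ κ₂ 0ℤ ⊎ k ≡ φ 0ℤ κ₂ → k <ℤ 0ℤ
    all-negative (inj₁ refl) = ℤ.<-trans ℓ₂₂<ℓ₀₂ (ℤ.<-trans ℓ₀₂<ℓ₂₀ ℓ₂₀<0)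
    all-negative (inj₂ (inj₁ refl)) = ℓ₂₀<0
    all-negative (inj₂ (inj₂ refl)) = ℤ.<-trans ℓ₀₂<ℓ₂₀ ℓ₂₀<0

  new-spread : Spread (λ k → 0ℤ <ℤ k ⊎ k <ℤ 0ℤ) (newPairs c₁ c₂ A)
  new-spread = spread-join ℤ.<-asym positive-spread negative-spread

  -- b = Φ(x₀,y₀) and the values in Φ(A) have level 0, so they are not new.
  old-values-not-new : ∀ n → n ≡ b ⊎ InΦ u₁ u₂ A n → n ∉ map φ² (newPairs c₁ c₂ A)
  old-values-not-new n n-old =
    spread-excludes new-spread (subst (λ k → Near K k n) φ-origin (level-0 n-old))
      [ ℤ.<-irrefl refl , ℤ.<-irrefl refl ]
    where
    level-0 : n ≡ b ⊎ InΦ u₁ u₂ A n → Near K (φ 0ℤ 0ℤ) n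
    level-0 (inj₁ refl) =
      subst (Near K (φ 0ℤ 0ℤ)) x₀y₀↦b (near-φ (level-zero x₀-small) (level-zero y₀-small))
    level-0 (inj₂ (a , a' , a∈A , a'∈A , refl)) = near-φ (A-near a∈A) (A-near a'∈A)

  extension : c₁ ≢ c₂ × c₁ ∉ A × c₂ ∉ A × RequiredCounts A b c₁ c₂
  extension = c₁≢c₂ , c₁∉A , c₂∉A ,
    required-counts A b c₁ c₂ c₁c₂↦b (proj₁ new-spread) old-values-not-new

bézout-cast : ∀ α β p q → 1 ℕ.+ q ℕ.* β ≡ p ℕ.* α → 1ℤ + + q * + β ≡ + p * + α
bézout-cast α β p q e = begin
  1ℤ + + q * + β     ≡⟨ cong (λ t → 1ℤ + t) (ℤ.pos-* q β) ⟨
  1ℤ + + (q ℕ.* β)   ≡⟨ ℤ.pos-+ 1 (q ℕ.* β) ⟨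
  + (1 ℕ.+ q ℕ.* β)  ≡⟨ cong +_ e ⟩
  + (p ℕ.* α)        ≡⟨ ℤ.pos-* p α ⟩
  + p * + α          ∎
  where open ≡-Reasoning

bézout-scale : ∀ α β p q b → 1ℤ + q * β ≡ p * α → α * (p * b) + β * (- q * b) ≡ b
bézout-scale α β p q b e = begin
  α * (p * b) + β * (- q * b) ≡⟨ collect α β p q b ⟩
  (p * α - q * β) * b        ≡⟨ cong (λ t → (t - q * β) * b) e ⟨
  (1ℤ + q * β - q * β) * b   ≡⟨ cancel q β b ⟩
  b                          ∎
  where
  open ≡-Reasoning
  collect : ∀ α β p q b → α * (p * b) + β * (- q * b) ≡ (p * α - q * β) * b
  collect = solve-∀
  cancel : ∀ q β b → (1ℤ + q * β - q * β) * b ≡ b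
  cancel = solve-∀

representable : ∀ u₁ u₂ → Coprime u₁ u₂ → ∀ b → ∃₂ λ x₀ y₀ → Φ u₁ u₂ x₀ y₀ ≡ b
representable u₁ u₂ coprime b with coprime-Bézout coprime
... | GCD.Bézout.+- x y eq =
  + x * b , - (+ y) * b , bézout-scale (+ u₁) (+ u₂) (+ x) (+ y) b (bézout-cast u₁ u₂ x y eq)
... | GCD.Bézout.-+ x y eq =
  - (+ x) * b , + y * b ,
  trans (ℤ.+-comm (+ u₁ * (- (+ x) * b)) (+ u₂ * (+ y * b)))
        (bézout-scale (+ u₂) (+ u₁) (+ y) (+ x) b (bézout-cast u₂ u₁ y x eq))

∣∣≤sum : ∀ {a A} → a ∈ A → ∣ a ∣ ℕ.≤ sum (map ∣_∣ A)
∣∣≤sum {A = a ∷ A} (here refl) = ℕ.m≤m+n ∣ a ∣ (sum (map ∣_∣ A))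
∣∣≤sum {A = a' ∷ A} (there a∈A) = ℕ.≤-trans (∣∣≤sum a∈A) (ℕ.m≤n+m _ ∣ a' ∣)

mainTheorem2 : (u₁ u₂ : ℕ) → 0 < u₁ → u₁ < u₂ → Coprime u₁ u₂ →
    (A : List ℤ) → Unique A → (b : ℤ) →
    ∃₂ λ c₁ c₂ → c₁ ≢ c₂ × c₁ ∉ A × c₂ ∉ A ×
      (let C = c₁ ∷ c₂ ∷ A in
        (R u₁ u₂ C b ≡ suc (R u₁ u₂ A b))
        × (∀ n → InΦ u₁ u₂ A n → n ≢ b → R u₁ u₂ C n ≡ R u₁ u₂ A n)
        × (∀ n → InΦ u₁ u₂ C n → ¬ (InΦ u₁ u₂ A n ⊎ n ≡ b) → R u₁ u₂ C n ≡ 1)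
        × (∀ n → ¬ InΦ u₁ u₂ C n → R u₁ u₂ C n ≡ 0))
mainTheorem2 u₁ u₂ 0<u₁ u₁<u₂ coprime A A-unique b = c₁ , c₂ , extension
  where
  x₀ y₀ : ℤ
  x₀ = proj₁ (representable u₁ u₂ coprime b)
  y₀ = proj₁ (proj₂ (representable u₁ u₂ coprime b))
  M : ℕ
  M = ∣ x₀ ∣ ℕ.+ ∣ y₀ ∣ ℕ.+ sum (map ∣_∣ A)
  open Construction u₁ u₂ 0<u₁ u₁<u₂ coprime A A-unique b x₀ y₀
    (proj₂ (proj₂ (representable u₁ u₂ coprime b))) M
    (ℕ.≤-trans (ℕ.m≤m+n ∣ x₀ ∣ ∣ y₀ ∣) (ℕ.m≤m+n _ _))
    (ℕ.≤-trans (ℕ.m≤n+m ∣ y₀ ∣ ∣ x₀ ∣) (ℕ.m≤m+n _ _))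
    (λ a∈A → ℕ.≤-trans (∣∣≤sum a∈A) (ℕ.m≤n+m _ _))
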